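{- Let $n\ge1$, let $x_1,\dots,x_n$ be distinct integers greater than $1$, and let $D=\{1,0,x_1,\dots,x_n\}$. If $(T,s)$ is an optimal signed tree realizing $D$ and $ab$ is an edge of $T$ with $s(ab)=-$, then $sdeg(a)=sdeg(b)=0$.
   Context: A signed tree is a pair $(T,s)$ with $T$ a finite tree and $s:E(T)\to\{+,-\}$. The signed degree $sdeg(v)$ of a vertex is the number of incident positive edges minus the number of incident negative edges. $(T,s)$ realizes $D$ if $D=\{sdeg(v):v\in V(T)\}$. $\sigma(D)$ is the minimum number of vertices of a tree $T$ such that some signed tree $(T,s)$ realizes $D$; a signed tree $(T,s)$ realizing $D$ is optimal if $|V(T)|=\sigma(D)$. -}

module Defs where

open import Data.Nat using (ℕ; _≤_)
open import Data.Integer using (ℤ; +_; -[1+_]; _+_)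
open import Data.Fin using (Fin)
open import Data.List using (List; []; _∷_; _++_; [_]; map; foldr; allFin; length)
open import Data.List.Relation.Unary.Linked using (Linked)
open import Data.List.Relation.Unary.Unique.Propositional using (Unique)
open import Data.List.Membership.Propositional using (_∈_)
open import Data.Maybe using (Maybe; just; nothing)
open import Data.Product using (Σ; ∃; _×_)
open import Relation.Binary.PropositionalEquality using (_≡_)
open import Relation.Nullary using (¬_)

data Sign : Set where
  pos neg : Sign

-- A signed (simple) graph on vertex set Fin n: s u v = nothing if uv is not
-- an edge, just σ if uv is an edge with sign σ.
record SignedGraph (n : ℕ) : Set where
  field
    s     : Fin n → Fin n → Maybe Sign
    symm  : ∀ u v → s u v ≡ s v u
    loopless : ∀ v → s v v ≡ nothing

module _ {n : ℕ} (G : SignedGraph n) where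
  open SignedGraph G

  Adj : Fin n → Fin n → Set
  Adj u v = ∃ λ σ → s u v ≡ just σ

  data Reach : Fin n → Fin n → Set where
    here : ∀ {u} → Reach u u
    step : ∀ {u w v} → Adj u w → Reach w v → Reach u v

  Connected : Set
  Connected = ∀ u v → Reach u v

  IsCycle : Fin n → List (Fin n) → Set
  IsCycle v ws = (2 ≤ length ws) × Unique (v ∷ ws) × Linked Adj (v ∷ ws ++ [ v ])

  Acyclic : Set
  Acyclic = ∀ v ws → ¬ IsCycle v ws

  IsTree : Set
  IsTree = Connected × Acyclic

  signVal : Maybe Sign → ℤ
  signVal nothing = + 0
  signVal (just pos) = + 1
  signVal (just neg) = -[1+ 0 ]

  sdeg : Fin n → ℤ
  sdeg v = foldr _+_ (+ 0) (map (λ u → signVal (s v u)) (allFin n))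

  -- (T,s) realizes D (D given as a list, read as a set)
  Realizes : List ℤ → Set
  Realizes D = (∀ v → sdeg v ∈ D) × (∀ d → d ∈ D → ∃ λ v → sdeg v ≡ d)

record SignedTree (n : ℕ) : Set where
  field
    graph  : SignedGraph n
    isTree : IsTree graph

RealizedBy : List ℤ → {n : ℕ} → SignedTree n → Set
RealizedBy D T = Realizes (SignedTree.graph T) D

-- optimal: |V(T)| = σ(D), i.e. T realizes D and no signed tree with fewer
-- vertices realizes D
Optimal : List ℤ → {n : ℕ} → SignedTree n → Set
Optimal D {n} T = RealizedBy D T × (∀ m (T' : SignedTree m) → RealizedBy D T' → n ≤ m)

-- A vertex of signed degree k ≥ 0 with m negative edges has degree k + 2m. Hence in a
-- tree with at least two vertices, deg v − 1 is at least excess k, where excess 0 = 1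
-- (a vertex of signed degree 0 is not a leaf) and excess k = k − 1 otherwise, and at
-- least excess k + 2 if k ≠ 0 and m ≥ 1. As Σ (deg v − 1) = N − 2 for a tree on N
-- vertices, picking one vertex for each value of D = {1, 0, x₁, …, xₙ} gives
-- N ≥ Σᵢ (xᵢ − 1) + 3, and N ≥ Σᵢ (xᵢ − 1) + 5 if a negative edge meets a vertex of
-- nonzero signed degree. But Σᵢ (xᵢ − 1) + 4 vertices suffice: start from a path with
-- signed degrees 1, 0, 0, 1 (its middle edge negative) and, for each xᵢ, hang xᵢ − 1
-- positive pendant edges on the current end vertex of signed degree 1, which thereby
-- gets signed degree xᵢ.
module Submission where

open import Defs
open import Data.Nat using (ℕ; _≤_)
open import Data.Integer using (ℤ; +_; _<_)
open import Data.List using (List; _∷_; length)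
open import Data.List.Relation.Unary.All using (All)
open import Data.List.Relation.Unary.Unique.Propositional using (Unique)
open import Data.Maybe using (just)
open import Data.Product using (_×_)
open import Relation.Binary.PropositionalEquality using (_≡_)

open import Data.Empty using (⊥-elim)
open import Data.Fin using (Fin; zero; suc; punchIn; _≟_; _↑ˡ_; _↑ʳ_; splitAt)
import Data.Fin.Properties as Finₚ
open import Data.Fin.Properties
  using (punchInᵢ≢i; punchIn-injective; any?; ↑ʳ-injective; splitAt⁻¹-↑ˡ; splitAt⁻¹-↑ʳ)
open import Data.Integer using (-[1+_]; ∣_∣; +≤+; +<+) renaming (_+_ to _+ℤ_; _-_ to _-ℤ_; _≤_ to _≤ℤ_)
import Data.Integer.Properties as ℤ
open import Data.Integer.Tactic.RingSolver using (solve-∀)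
open import Data.List using ([]; _++_; [_]; map; foldr; tabulate; initLast; _∷ʳ′_)
open import Data.List.Membership.Propositional using (_∈_; _∉_)
open import Data.List.Membership.Propositional.Properties using (∈-++⁺ʳ; ∈-∃++)
open import Data.List.Properties
  using (map-cong-local; map-tabulate; map-∘; map-++; length-map; length-++-comm; length-++-sucʳ; ++-assoc)
import Data.List.Relation.Binary.Permutation.Setoid.Properties as Permutationₚ
import Data.List.Relation.Unary.All as All
import Data.List.Relation.Unary.All.Properties as Allₚ
open import Data.List.Relation.Unary.All using ([]; _∷_)
open import Data.List.Relation.Unary.AllPairs using ([]; _∷_)
import Data.List.Relation.Unary.Any as Any
open import Data.List.Relation.Unary.Any using (here; there)
open import Data.List.Relation.Unary.Linked using (Linked; []; [-]; _∷_)
import Data.List.Relation.Unary.Linked.Properties as Linkedₚ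
import Data.List.Relation.Unary.Unique.Propositional.Properties as Uniqueₚ
open import Data.Maybe using (Maybe; nothing)
open import Data.Nat using (zero; suc; _+_; _*_; z≤n; s≤s; _≤?_)
open import Data.Nat.ListAction using (sum)
open import Data.Nat.Properties hiding (_≟_)
import Data.Nat.Tactic.RingSolver as ℕ-Solver
open import Algebra.Properties.CommutativeMonoid.Sum +-0-commutativeMonoid
  using (sum-remove; ∑-distrib-+; sum-cong-≗; sum-replicate-zero) renaming (sum to ∑)
open import Data.Product using (Σ; ∃; ∃₂; _,_; proj₁; proj₂)
import Data.Product as Product
open import Data.Sum using (_⊎_; inj₁; inj₂)
open import Data.Vec.Functional using (updateAt)
open import Data.Vec.Functional.Properties using (updateAt-updates; updateAt-minimal)
open import Function using (_∘_; const; id)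
open import Relation.Binary.PropositionalEquality
  using (_≢_; refl; sym; trans; cong; cong₂; subst; subst₂; module ≡-Reasoning) renaming (setoid to ≡-setoid)
open import Relation.Nullary using (Dec; yes; no; ¬?)
open import Relation.Nullary.Decidable using (_×-dec_; decidable-stable)

∑-mono-≤ : ∀ {n} {f g : Fin n → ℕ} → (∀ i → f i ≤ g i) → ∑ f ≤ ∑ g
∑-mono-≤ {zero}  f≤g = z≤n
∑-mono-≤ {suc n} f≤g = +-mono-≤ (f≤g zero) (∑-mono-≤ (f≤g ∘ suc))

∑-updateAt-0 : ∀ {n} (f : Fin n → ℕ) i → ∑ f ≡ f i + ∑ (updateAt f i (const 0))
∑-updateAt-0 {suc n} f i = trans (sum-remove f) (cong (_+_ (f i)) (sym ∑-f′))
  where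
  f′ : Fin (suc n) → ℕ
  f′ = updateAt f i (const 0)
  ∑-f′ : ∑ f′ ≡ ∑ (f ∘ punchIn i)
  ∑-f′ = trans (sum-remove f′)
    (cong₂ _+_ (updateAt-updates i f) (sum-cong-≗ λ j → updateAt-minimal (punchIn i j) i f (punchInᵢ≢i i j)))

term≤∑ : ∀ {n} (f : Fin n → ℕ) i → f i ≤ ∑ f
term≤∑ f i = subst (f i ≤_) (sym (∑-updateAt-0 f i)) (m≤m+n (f i) _)

sum-map-≤-∑ : ∀ {n} (f : Fin n → ℕ) {is} → Unique is → sum (map f is) ≤ ∑ f
sum-map-≤-∑ f {[]} [] = z≤n
sum-map-≤-∑ f {i ∷ is} (i∉is ∷ uniq) = begin
  f i + sum (map f is)   ≡⟨ cong (λ l → f i + sum l) f≡f′-on-is ⟩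
  f i + sum (map f′ is)  ≤⟨ +-monoʳ-≤ (f i) (sum-map-≤-∑ f′ uniq) ⟩
  f i + ∑ f′             ≡⟨ ∑-updateAt-0 f i ⟨
  ∑ f                    ∎
  where
  open ≤-Reasoning
  f′ : Fin _ → ℕ
  f′ = updateAt f i (const 0)
  f≡f′-on-is : map f is ≡ map f′ is
  f≡f′-on-is = map-cong-local (All.map (λ i≢j → sym (updateAt-minimal _ i f (i≢j ∘ sym))) i∉is)

∑-concentrated : ∀ {n} (f : Fin n → ℕ) {i} → (∀ j → j ≢ i → f j ≡ 0) → ∑ f ≡ f i
∑-concentrated {suc n} f {i} vanishes = begin
  ∑ f                         ≡⟨ sum-remove f ⟩
  f i + ∑ (f ∘ punchIn i)     ≡⟨ cong (_+_ (f i)) (sum-cong-≗ λ j → vanishes (punchIn i j) (punchInᵢ≢i i j)) ⟩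
  f i + ∑ {n} (const 0)       ≡⟨ cong (_+_ (f i)) (sum-replicate-zero n) ⟩
  f i + 0                     ≡⟨ +-identityʳ (f i) ⟩
  f i                         ∎
  where open ≡-Reasoning

∑-ones : ∀ n → ∑ {n} (const 1) ≡ n
∑-ones zero    = refl
∑-ones (suc n) = cong suc (∑-ones n)

∑-mono-≤-slack : ∀ {n} {f g : Fin n → ℕ} {i c} → (∀ j → f j ≤ g j) → f i + c ≤ g i → ∑ f + c ≤ ∑ g
∑-mono-≤-slack {suc n} {f} {g} {i} {c} f≤g fi+c≤gi = begin
  ∑ f + c                            ≡⟨ cong (_+ c) (sum-remove f) ⟩
  f i + ∑ (f ∘ punchIn i) + c        ≡⟨ +-assoc (f i) _ c ⟩
  f i + (∑ (f ∘ punchIn i) + c)      ≡⟨ cong (_+_ (f i)) (+-comm _ c) ⟩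
  f i + (c + ∑ (f ∘ punchIn i))      ≡⟨ +-assoc (f i) c _ ⟨
  f i + c + ∑ (f ∘ punchIn i)        ≤⟨ +-mono-≤ fi+c≤gi (∑-mono-≤ (f≤g ∘ punchIn i)) ⟩
  g i + ∑ (g ∘ punchIn i)            ≡⟨ sum-remove g ⟨
  ∑ g                                ∎
  where open ≤-Reasoning

Unique⇒length≤ : ∀ {n} {is : List (Fin n)} → Unique is → length is ≤ n
Unique⇒length≤ {n} {is} uniq = subst₂ _≤_ (count is) (∑-ones n) (sum-map-≤-∑ (const 1) uniq)
  where
  count : ∀ (is : List (Fin n)) → sum (map (const 1) is) ≡ length is
  count []       = refl
  count (_ ∷ is) = cong suc (count is)

module _ {A : Set} {R : A → A → Set} where

  Linked-split : ∀ xs {y ys} → Linked R (xs ++ y ∷ ys) → Linked R (xs ++ [ y ]) × Linked R (y ∷ ys)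
  Linked-split []           l            = [-] , l
  Linked-split (x ∷ [])     (r ∷ l)      = r ∷ [-] , l
  Linked-split (x ∷ x′ ∷ xs) (r ∷ l)     = Product.map₁ (r ∷_) (Linked-split (x′ ∷ xs) l)

  Linked-join : ∀ xs {y ys} → Linked R (xs ++ [ y ]) → Linked R (y ∷ ys) → Linked R (xs ++ y ∷ ys)
  Linked-join []            _       l′ = l′
  Linked-join (x ∷ [])      (r ∷ _) l′ = r ∷ l′
  Linked-join (x ∷ x′ ∷ xs) (r ∷ l) l′ = r ∷ Linked-join (x′ ∷ xs) l l′

Unique-++⁻ˡ : ∀ {A : Set} (xs : List A) {ys} → Unique (xs ++ ys) → Unique xs
Unique-++⁻ˡ []       _          = []
Unique-++⁻ˡ (x ∷ xs) (x∉ ∷ uniq) = Allₚ.++⁻ˡ xs x∉ ∷ Unique-++⁻ˡ xs uniq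

preimages : ∀ {A B : Set} (f : A → B) (ys : List B) → (∀ y → y ∈ ys → ∃ λ x → f x ≡ y) →
            ∃ λ xs → map f xs ≡ ys
preimages f []       _        = [] , refl
preimages f (y ∷ ys) surjects with surjects y (here refl) | preimages f ys (λ y′ → surjects y′ ∘ there)
... | x , fx≡y | xs , fxs≡ys = x ∷ xs , cong₂ _∷_ fx≡y fxs≡ys

isPos isNeg isEdge : Maybe Sign → ℕ
isPos (just pos) = 1
isPos _          = 0
isNeg (just neg) = 1
isNeg _          = 0
isEdge (just _)  = 1
isEdge nothing   = 0

isEdge≡isPos+isNeg : ∀ e → isEdge e ≡ isPos e + isNeg e
isEdge≡isPos+isNeg (just pos) = refl
isEdge≡isPos+isNeg (just neg) = refl
isEdge≡isPos+isNeg nothing    = refl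

signVal≡isPos-isNeg : ∀ {n} (G : SignedGraph n) e → signVal G e ≡ + isPos e -ℤ + isNeg e
signVal≡isPos-isNeg G (just pos) = refl
signVal≡isPos-isNeg G (just neg) = refl
signVal≡isPos-isNeg G nothing    = refl

module _ {n : ℕ} (G : SignedGraph n) where
  open SignedGraph G

  posDeg negDeg deg : Fin n → ℕ
  posDeg v = ∑ (isPos ∘ s v)
  negDeg v = ∑ (isNeg ∘ s v)
  deg    v = ∑ (isEdge ∘ s v)

  deg≡posDeg+negDeg : ∀ v → deg v ≡ posDeg v + negDeg v
  deg≡posDeg+negDeg v = trans (sum-cong-≗ (isEdge≡isPos+isNeg ∘ s v)) (∑-distrib-+ (isPos ∘ s v) (isNeg ∘ s v))

  foldr-signVal : ∀ {k} (e : Fin k → Maybe Sign) →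
    foldr _+ℤ_ (+ 0) (tabulate (signVal G ∘ e)) ≡ + ∑ (isPos ∘ e) -ℤ + ∑ (isNeg ∘ e)
  foldr-signVal {zero}  e = refl
  foldr-signVal {suc k} e = begin
    signVal G (e zero) +ℤ foldr _+ℤ_ (+ 0) (tabulate (signVal G ∘ e ∘ suc))
      ≡⟨ cong₂ _+ℤ_ (signVal≡isPos-isNeg G (e zero)) (foldr-signVal (e ∘ suc)) ⟩
    (+ isPos (e zero) -ℤ + isNeg (e zero)) +ℤ (+ ∑ (isPos ∘ e ∘ suc) -ℤ + ∑ (isNeg ∘ e ∘ suc))
      ≡⟨ regroup (+ isPos (e zero)) (+ isNeg (e zero)) (+ ∑ (isPos ∘ e ∘ suc)) (+ ∑ (isNeg ∘ e ∘ suc)) ⟩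
    (+ isPos (e zero) +ℤ + ∑ (isPos ∘ e ∘ suc)) -ℤ (+ isNeg (e zero) +ℤ + ∑ (isNeg ∘ e ∘ suc))
      ≡⟨ cong₂ _-ℤ_ (ℤ.pos-+ (isPos (e zero)) _) (ℤ.pos-+ (isNeg (e zero)) _) ⟨
    + ∑ (isPos ∘ e) -ℤ + ∑ (isNeg ∘ e)  ∎
    where
    open ≡-Reasoning
    regroup : ∀ a b c d → (a -ℤ b) +ℤ (c -ℤ d) ≡ (a +ℤ c) -ℤ (b +ℤ d)
    regroup = solve-∀

  sdeg≡posDeg-negDeg : ∀ v → sdeg G v ≡ + posDeg v -ℤ + negDeg v
  sdeg≡posDeg-negDeg v = trans (cong (foldr _+ℤ_ (+ 0)) (map-tabulate id (signVal G ∘ s v))) (foldr-signVal (s v))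

  posDeg≡sdeg+negDeg : ∀ {v k} → sdeg G v ≡ + k → posDeg v ≡ k + negDeg v
  posDeg≡sdeg+negDeg {v} {k} sdeg≡k = ℤ.+-injective (begin
    + posDeg v                                ≡⟨ cancel (+ posDeg v) (+ negDeg v) ⟩
    (+ posDeg v -ℤ + negDeg v) +ℤ + negDeg v  ≡⟨ cong (_+ℤ + negDeg v) (trans (sym (sdeg≡posDeg-negDeg v)) sdeg≡k) ⟩
    + k +ℤ + negDeg v                         ≡⟨ ℤ.pos-+ k (negDeg v) ⟨
    + (k + negDeg v)                          ∎)
    where
    open ≡-Reasoning
    cancel : ∀ a b → a ≡ (a -ℤ b) +ℤ b
    cancel = solve-∀

  deg≡sdeg+2*negDeg : ∀ {v k} → sdeg G v ≡ + k → deg v ≡ k + 2 * negDeg v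
  deg≡sdeg+2*negDeg {v} {k} sdeg≡k = begin
    deg v                         ≡⟨ deg≡posDeg+negDeg v ⟩
    posDeg v + negDeg v           ≡⟨ cong (_+ negDeg v) (posDeg≡sdeg+negDeg sdeg≡k) ⟩
    k + negDeg v + negDeg v       ≡⟨ +-assoc k (negDeg v) (negDeg v) ⟩
    k + (negDeg v + negDeg v)     ≡⟨ cong (λ m → k + (negDeg v + m)) (+-identityʳ (negDeg v)) ⟨
    k + 2 * negDeg v              ∎
    where open ≡-Reasoning

-- Cycles and leaves

module _ {n : ℕ} (G : SignedGraph n) where
  open SignedGraph G
  private module ↭ = Permutationₚ (≡-setoid (Fin n))

  Adj-sym : ∀ {u w} → Adj G u w → Adj G w u
  Adj-sym {u} {w} (σ , e) = σ , trans (symm w u) e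

  Adj-irrefl : ∀ {u w} → Adj G u w → u ≢ w
  Adj-irrefl {u} (σ , e) refl with trans (sym e) (loopless u)
  ... | ()

  IsCycle-rotate : ∀ {v} pre {z} post → IsCycle G v (pre ++ z ∷ post) → IsCycle G z (post ++ v ∷ pre)
  IsCycle-rotate {v} pre {z} post (len , uniq , linked) = len′ , uniq′ , linked′
    where
    len′ : 2 ≤ length (post ++ v ∷ pre)
    len′ = subst (2 ≤_) (suc-injective (length-++-comm (v ∷ pre) (z ∷ post))) len
    uniq′ : Unique (z ∷ post ++ v ∷ pre)
    uniq′ = ↭.Unique-resp-↭ (↭.++-comm (v ∷ pre) (z ∷ post)) uniq
    halves : Linked (Adj G) (v ∷ pre ++ [ z ]) × Linked (Adj G) (z ∷ post ++ [ v ])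
    halves = Linked-split (v ∷ pre) (subst (λ l → Linked (Adj G) (v ∷ l)) (++-assoc pre (z ∷ post) [ v ]) linked)
    linked′ : Linked (Adj G) (z ∷ (post ++ v ∷ pre) ++ [ z ])
    linked′ = subst (λ l → Linked (Adj G) (z ∷ l)) (sym (++-assoc post (v ∷ pre) [ z ]))
                (Linked-join (z ∷ post) (proj₂ halves) (proj₁ halves))

  IsCycle⇒two-neighbours : ∀ {z} ws → IsCycle G z ws → ∃₂ λ u w → u ≢ w × Adj G z u × Adj G z w
  IsCycle⇒two-neighbours (u ∷ ws) cycle with initLast ws
  IsCycle⇒two-neighbours (u ∷ _) (s≤s () , _) | []
  IsCycle⇒two-neighbours {z} (u ∷ _) (_ , (_ ∷ u∉ ∷ _) , (z~u ∷ linked)) | ini ∷ʳ′ w =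
    u , w , All.lookup u∉ (∈-++⁺ʳ ini (here refl)) , z~u , Adj-sym w~z
    where
    w~z : Adj G w z
    w~z with Linked-split (u ∷ ini) (subst (λ l → Linked (Adj G) (u ∷ l)) (++-assoc ini [ w ] [ z ]) linked)
    ... | _ , (w~z ∷ [-]) = w~z

  on-cycle⇒two-neighbours : ∀ {v ws z} → IsCycle G v ws → z ∈ v ∷ ws →
                            ∃₂ λ u w → u ≢ w × Adj G z u × Adj G z w
  on-cycle⇒two-neighbours {ws = ws} cycle (here refl) = IsCycle⇒two-neighbours ws cycle
  on-cycle⇒two-neighbours {ws = ws} cycle (there z∈ws) with ∈-∃++ z∈ws
  ... | pre , post , refl = IsCycle⇒two-neighbours (post ++ _ ∷ pre) (IsCycle-rotate pre post cycle)

  Adj? : ∀ u w → Dec (Adj G u w)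
  Adj? u w with s u w
  ... | just σ  = yes (σ , refl)
  ... | nothing = no λ ()

  Adj⇒1≤deg : ∀ {v w} → Adj G v w → 1 ≤ deg G v
  Adj⇒1≤deg {v} {w} (σ , e) = subst (λ x → isEdge x ≤ deg G v) e (term≤∑ (isEdge ∘ s v) w)

  neighbours≡⇒deg≤1 : ∀ {v p} → (∀ w → Adj G v w → w ≡ p) → deg G v ≤ 1
  neighbours≡⇒deg≤1 {v} {p} neighbour≡p =
    subst (_≤ 1) (sym (∑-concentrated (isEdge ∘ s v) no-other-edge)) (isEdge≤1 (s v p))
    where
    isEdge≤1 : ∀ e → isEdge e ≤ 1
    isEdge≤1 (just _) = ≤-refl
    isEdge≤1 nothing  = z≤n
    no-other-edge : ∀ j → j ≢ p → isEdge (s v j) ≡ 0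
    no-other-edge j j≢p with s v j in e
    ... | nothing = refl
    ... | just σ  = ⊥-elim (j≢p (neighbour≡p j (σ , e)))

  another-neighbour : ∀ {v} → 2 ≤ deg G v → ∀ p → ∃ λ w → Adj G v w × w ≢ p
  another-neighbour {v} 2≤deg p with any? (λ w → Adj? v w ×-dec ¬? (w ≟ p))
  ... | yes found = found
  ... | no none   = ⊥-elim (<⇒≱ 2≤deg (neighbours≡⇒deg≤1 λ w v~w →
                      decidable-stable (w ≟ p) λ w≢p → none (w , v~w , w≢p)))

  chord⇒cycle : ∀ {h p rest w} → Unique (h ∷ p ∷ rest) → Linked (Adj G) (h ∷ p ∷ rest) →
                Adj G h w → w ∈ rest → ∃ (IsCycle G h)
  chord⇒cycle {h} {p} {w = w} uniq linked h~w w∈rest with ∈-∃++ w∈rest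
  ... | pre , post , refl = p ∷ pre ++ [ w ] , len , uniq′ , linked′
    where
    len : 2 ≤ length (p ∷ pre ++ [ w ])
    len = s≤s (subst (1 ≤_) (sym (length-++-sucʳ pre w [])) (s≤s z≤n))
    uniq′ : Unique (h ∷ p ∷ pre ++ [ w ])
    uniq′ = Unique-++⁻ˡ (h ∷ p ∷ pre ++ [ w ])
              (subst (λ l → Unique (h ∷ p ∷ l)) (sym (++-assoc pre [ w ] post)) uniq)
    linked′ : Linked (Adj G) (h ∷ (p ∷ pre ++ [ w ]) ++ [ h ])
    linked′ = subst (λ l → Linked (Adj G) (h ∷ p ∷ l)) (sym (++-assoc pre [ w ] [ h ]))
                (Linked-join (h ∷ p ∷ pre) (proj₁ (Linked-split (h ∷ p ∷ pre) linked)) (Adj-sym h~w ∷ [-]))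

module _ {n : ℕ} (G : SignedGraph n) (acyclic : Acyclic G) where

  private
    SimplePath : Fin n → List (Fin n) → Set
    SimplePath h t = Unique (h ∷ t) × Linked (Adj G) (h ∷ t)

    extend : (∀ v → 2 ≤ deg G v) → ∀ {h t} → SimplePath h t → ∃ λ w → SimplePath w (h ∷ t)
    extend 2≤deg {h} {[]} (uniq , linked) with another-neighbour G (2≤deg h) h
    ... | w , h~w , w≢h = w , ((w≢h ∷ []) ∷ uniq) , (Adj-sym G h~w ∷ linked)
    extend 2≤deg {h} {p ∷ rest} (uniq , linked) with another-neighbour G (2≤deg h) p
    ... | w , h~w , w≢p = w , ((w≢h ∷ w≢p ∷ w∉rest) ∷ uniq) , (Adj-sym G h~w ∷ linked)
      where
      w≢h : w ≢ h
      w≢h w≡h = Adj-irrefl G h~w (sym w≡h)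
      w∉rest : All (w ≢_) rest
      w∉rest = All.tabulate λ {x} x∈rest w≡x →
        let (ws , cycle) = chord⇒cycle G uniq linked h~w (subst (_∈ rest) (sym w≡x) x∈rest)
        in acyclic h ws cycle

    path-of-length : (∀ v → 2 ≤ deg G v) → Fin n → ∀ k → ∃₂ λ h t → length t ≡ k × SimplePath h t
    path-of-length 2≤deg v zero    = v , [] , refl , ([] ∷ []) , [-]
    path-of-length 2≤deg v (suc k) with path-of-length 2≤deg v k
    ... | h , t , len , path with extend 2≤deg path
    ... | w , path′ = w , h ∷ t , cong suc len , path′

  leaf : Fin n → ∃ λ ℓ → deg G ℓ ≤ 1
  leaf v with any? (λ ℓ → deg G ℓ ≤? 1)
  ... | yes found = found
  ... | no none with path-of-length (λ ℓ → ≰⇒> λ deg≤1 → none (ℓ , deg≤1)) v n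
  ... | h , t , len , uniq , _ = ⊥-elim (<⇒≱ (s≤s (≤-reflexive (sym len))) (Unique⇒length≤ uniq))

-- Deleting a vertex, and the degree sum of a forest

deleteVertex : ∀ {n} → SignedGraph (suc n) → Fin (suc n) → SignedGraph n
deleteVertex G ℓ = record
  { s        = λ u w → s (punchIn ℓ u) (punchIn ℓ w)
  ; symm     = λ u w → symm (punchIn ℓ u) (punchIn ℓ w)
  ; loopless = λ v → loopless (punchIn ℓ v)
  }
  where open SignedGraph G

Acyclic-deleteVertex : ∀ {n} (G : SignedGraph (suc n)) ℓ → Acyclic G → Acyclic (deleteVertex G ℓ)
Acyclic-deleteVertex G ℓ acyclic v ws (len , uniq , linked) =
  acyclic (punchIn ℓ v) (map (punchIn ℓ) ws)
    ( subst (2 ≤_) (sym (length-map (punchIn ℓ) ws)) len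
    , Uniqueₚ.map⁺ (punchIn-injective ℓ _ _) uniq
    , subst (λ l → Linked (Adj G) (punchIn ℓ v ∷ l)) (map-++ (punchIn ℓ) ws [ v ]) (Linkedₚ.map⁺ linked))

∑deg-deleteVertex : ∀ {n} (G : SignedGraph (suc n)) ℓ → ∑ (deg G) ≡ 2 * deg G ℓ + ∑ (deg (deleteVertex G ℓ))
∑deg-deleteVertex G ℓ = begin
  ∑ (deg G)
    ≡⟨ sum-remove (deg G) ⟩
  deg G ℓ + ∑ (deg G ∘ punchIn ℓ)
    ≡⟨ cong (_+_ (deg G ℓ)) (sum-cong-≗ λ j → sum-remove (isEdge ∘ s (punchIn ℓ j))) ⟩
  deg G ℓ + ∑ (λ j → isEdge (s (punchIn ℓ j) ℓ) + deg G′ j)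
    ≡⟨ cong (_+_ (deg G ℓ)) (∑-distrib-+ (λ j → isEdge (s (punchIn ℓ j) ℓ)) (deg G′)) ⟩
  deg G ℓ + (∑ (λ j → isEdge (s (punchIn ℓ j) ℓ)) + ∑ (deg G′))
    ≡⟨ cong (λ d → deg G ℓ + (d + ∑ (deg G′))) edges-at-ℓ ⟩
  deg G ℓ + (deg G ℓ + ∑ (deg G′))
    ≡⟨ +-assoc (deg G ℓ) (deg G ℓ) _ ⟨
  deg G ℓ + deg G ℓ + ∑ (deg G′)
    ≡⟨ cong (λ d → deg G ℓ + d + ∑ (deg G′)) (+-identityʳ (deg G ℓ)) ⟨
  2 * deg G ℓ + ∑ (deg G′)  ∎
  where
  open ≡-Reasoning
  open SignedGraph G
  G′ : SignedGraph _
  G′ = deleteVertex G ℓ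
  edges-at-ℓ : ∑ (λ j → isEdge (s (punchIn ℓ j) ℓ)) ≡ deg G ℓ
  edges-at-ℓ = begin
    ∑ (λ j → isEdge (s (punchIn ℓ j) ℓ))      ≡⟨ sum-cong-≗ (λ j → cong isEdge (symm (punchIn ℓ j) ℓ)) ⟩
    ∑ (isEdge ∘ s ℓ ∘ punchIn ℓ)              ≡⟨ cong (λ e → isEdge e + ∑ (isEdge ∘ s ℓ ∘ punchIn ℓ)) (loopless ℓ) ⟨
    isEdge (s ℓ ℓ) + ∑ (isEdge ∘ s ℓ ∘ punchIn ℓ) ≡⟨ sum-remove (isEdge ∘ s ℓ) ⟨
    deg G ℓ                                   ∎

∑deg+2≤2n : ∀ {n} (G : SignedGraph n) → Fin n → Acyclic G → ∑ (deg G) + 2 ≤ 2 * n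
∑deg+2≤2n {suc zero}    G _ _ rewrite SignedGraph.loopless G zero = ≤-refl
∑deg+2≤2n {suc (suc n)} G _ acyclic = begin
  ∑ (deg G) + 2                               ≡⟨ cong (_+ 2) (∑deg-deleteVertex G ℓ) ⟩
  2 * deg G ℓ + ∑ (deg G′) + 2                ≤⟨ +-monoˡ-≤ 2 (+-monoˡ-≤ (∑ (deg G′)) (*-monoʳ-≤ 2 deg≤1)) ⟩
  2 + (∑ (deg G′) + 2)                        ≤⟨ +-monoʳ-≤ 2 (∑deg+2≤2n G′ zero (Acyclic-deleteVertex G ℓ acyclic)) ⟩
  2 + 2 * suc n                               ≡⟨ *-suc 2 (suc n) ⟨
  2 * suc (suc n)                             ∎
  where
  open ≤-Reasoning
  ℓ : Fin (suc (suc n))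
  ℓ = proj₁ (leaf G acyclic zero)
  deg≤1 : deg G ℓ ≤ 1
  deg≤1 = proj₂ (leaf G acyclic zero)
  G′ : SignedGraph (suc n)
  G′ = deleteVertex G ℓ

edgeTo : ∀ {n} → Fin n → Sign → Fin n → Maybe Sign
edgeTo u σ v with v ≟ u
... | yes _ = just σ
... | no _  = nothing

edgeTo-self : ∀ {n} (u : Fin n) σ → edgeTo u σ u ≡ just σ
edgeTo-self u σ with u ≟ u
... | yes _   = refl
... | no u≢u = ⊥-elim (u≢u refl)

edgeTo-other : ∀ {n} {u v : Fin n} σ → v ≢ u → edgeTo u σ v ≡ nothing
edgeTo-other {u = u} {v} σ v≢u with v ≟ u
... | yes v≡u = ⊥-elim (v≢u v≡u)
... | no _    = refl

edgeTo-just : ∀ {n} {u v : Fin n} {σ τ} → edgeTo u σ v ≡ just τ → v ≡ u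
edgeTo-just {u = u} {v} e with v ≟ u
edgeTo-just _  | yes v≡u = v≡u
edgeTo-just () | no _

-- the new leaf is vertex zero, and an old vertex v is renamed suc v
addLeaf : ∀ {n} → SignedGraph n → Fin n → Sign → SignedGraph (suc n)
addLeaf {n} G u σ = record { s = s′ ; symm = symm′ ; loopless = loopless′ }
  where
  open SignedGraph G
  s′ : Fin (suc n) → Fin (suc n) → Maybe Sign
  s′ zero    zero    = nothing
  s′ zero    (suc w) = edgeTo u σ w
  s′ (suc v) zero    = edgeTo u σ v
  s′ (suc v) (suc w) = s v w
  symm′ : ∀ v w → s′ v w ≡ s′ w v
  symm′ zero    zero    = refl
  symm′ zero    (suc w) = refl
  symm′ (suc v) zero    = refl
  symm′ (suc v) (suc w) = symm v w
  loopless′ : ∀ v → s′ v v ≡ nothing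
  loopless′ zero    = refl
  loopless′ (suc v) = loopless v

module _ {n : ℕ} (G : SignedGraph n) (u : Fin n) (σ : Sign) where
  private
    G′ : SignedGraph (suc n)
    G′ = addLeaf G u σ

    Reach-suc : ∀ {v w} → Reach G v w → Reach G′ (suc v) (suc w)
    Reach-suc here          = here
    Reach-suc (step v~x r) = step v~x (Reach-suc r)

    Reach-trans : ∀ {v w x} → Reach G′ v w → Reach G′ w x → Reach G′ v x
    Reach-trans here          r′ = r′
    Reach-trans (step v~y r) r′ = step v~y (Reach-trans r r′)

    leaf~anchor : Adj G′ zero (suc u)
    leaf~anchor = σ , edgeTo-self u σ

    only-neighbour : ∀ w → Adj G′ zero w → w ≡ suc u
    only-neighbour (suc w) (τ , e) = cong suc (edgeTo-just e)

    old-vertices : (vs : List (Fin (suc n))) → zero ∉ vs → ∃ λ vs′ → vs ≡ map suc vs′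
    old-vertices []         _       = [] , refl
    old-vertices (zero ∷ _)  zero∉ = ⊥-elim (zero∉ (here refl))
    old-vertices (suc v ∷ vs) zero∉ = Product.map (v ∷_) (cong (suc v ∷_)) (old-vertices vs (zero∉ ∘ there))

  Connected-addLeaf : Connected G → Connected G′
  Connected-addLeaf connected zero    zero    = here
  Connected-addLeaf connected zero    (suc w) = step leaf~anchor (Reach-suc (connected u w))
  Connected-addLeaf connected (suc v) zero    =
    Reach-trans (Reach-suc (connected v u)) (step (Adj-sym G′ {zero} {suc u} leaf~anchor) here)
  Connected-addLeaf connected (suc v) (suc w) = Reach-suc (connected v w)

  Acyclic-addLeaf : Acyclic G → Acyclic G′
  Acyclic-addLeaf acyclic v ws cycle with Any.any? (zero ≟_) (v ∷ ws)
  ... | yes zero∈ with on-cycle⇒two-neighbours G′ cycle zero∈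
  ...   | x , y , x≢y , 0~x , 0~y = x≢y (trans (only-neighbour x 0~x) (sym (only-neighbour y 0~y)))
  Acyclic-addLeaf acyclic v ws (len , uniq , linked) | no zero∉ with old-vertices (v ∷ ws) zero∉
  ... | v′ ∷ ws′ , refl = acyclic v′ ws′
    ( subst (2 ≤_) (length-map suc ws′) len
    , Uniqueₚ.map⁻ uniq
    , Linkedₚ.map⁻ (subst (λ l → Linked (Adj G′) (suc v′ ∷ l)) (sym (map-++ suc ws′ [ v′ ])) linked))

  IsTree-addLeaf : IsTree G → IsTree G′
  IsTree-addLeaf (connected , acyclic) = Connected-addLeaf connected , Acyclic-addLeaf acyclic

sign : Sign → ℤ
sign pos = + 1
sign neg = -[1+ 0 ]

signVal-just≡sign : ∀ {n} (G : SignedGraph n) σ → signVal G (just σ) ≡ sign σ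
signVal-just≡sign G pos = refl
signVal-just≡sign G neg = refl

module _ {n : ℕ} (G : SignedGraph n) (u : Fin n) (σ : Sign) where
  private
    G′ : SignedGraph (suc n)
    G′ = addLeaf G u σ

    sdeg-suc : ∀ v → sdeg G′ (suc v) ≡ sdeg G v +ℤ signVal G (edgeTo u σ v)
    sdeg-suc v = begin
      sdeg G′ (suc v)                                 ≡⟨ sdeg≡posDeg-negDeg G′ (suc v) ⟩
      + (a + posDeg G v) -ℤ + (b + negDeg G v)        ≡⟨ cong₂ _-ℤ_ (ℤ.pos-+ a (posDeg G v)) (ℤ.pos-+ b (negDeg G v)) ⟩
      (+ a +ℤ + posDeg G v) -ℤ (+ b +ℤ + negDeg G v)  ≡⟨ regroup (+ a) (+ b) (+ posDeg G v) (+ negDeg G v) ⟩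
      (+ posDeg G v -ℤ + negDeg G v) +ℤ (+ a -ℤ + b)  ≡⟨ cong₂ _+ℤ_ (sdeg≡posDeg-negDeg G v) (signVal≡isPos-isNeg G e) ⟨
      sdeg G v +ℤ signVal G e                         ∎
      where
      open ≡-Reasoning
      e : Maybe Sign
      e = edgeTo u σ v
      a b : ℕ
      a = isPos e
      b = isNeg e
      regroup : ∀ a b p m → (a +ℤ p) -ℤ (b +ℤ m) ≡ (p -ℤ m) +ℤ (a -ℤ b)
      regroup = solve-∀

  sdeg-addLeaf-leaf : sdeg G′ zero ≡ sign σ
  sdeg-addLeaf-leaf = begin
    sdeg G′ zero                                          ≡⟨ sdeg≡posDeg-negDeg G′ zero ⟩
    + ∑ (isPos ∘ edgeTo u σ) -ℤ + ∑ (isNeg ∘ edgeTo u σ)  ≡⟨ cong₂ _-ℤ_ (cong +_ (at-u isPos refl)) (cong +_ (at-u isNeg refl)) ⟩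
    + isPos (just σ) -ℤ + isNeg (just σ)                  ≡⟨ signVal≡isPos-isNeg G (just σ) ⟨
    signVal G (just σ)                                    ≡⟨ signVal-just≡sign G σ ⟩
    sign σ                                                ∎
    where
    open ≡-Reasoning
    at-u : (f : Maybe Sign → ℕ) → f nothing ≡ 0 → ∑ (f ∘ edgeTo u σ) ≡ f (just σ)
    at-u f f-nothing =
      trans (∑-concentrated (f ∘ edgeTo u σ) λ v v≢u → trans (cong f (edgeTo-other σ v≢u)) f-nothing)
            (cong f (edgeTo-self u σ))

  sdeg-addLeaf-anchor : sdeg G′ (suc u) ≡ sdeg G u +ℤ sign σ
  sdeg-addLeaf-anchor = begin
    sdeg G′ (suc u)                         ≡⟨ sdeg-suc u ⟩
    sdeg G u +ℤ signVal G (edgeTo u σ u)    ≡⟨ cong (λ e → sdeg G u +ℤ signVal G e) (edgeTo-self u σ) ⟩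
    sdeg G u +ℤ signVal G (just σ)          ≡⟨ cong (sdeg G u +ℤ_) (signVal-just≡sign G σ) ⟩
    sdeg G u +ℤ sign σ                      ∎
    where open ≡-Reasoning

  sdeg-addLeaf-other : ∀ {v} → v ≢ u → sdeg G′ (suc v) ≡ sdeg G v
  sdeg-addLeaf-other {v} v≢u = begin
    sdeg G′ (suc v)                         ≡⟨ sdeg-suc v ⟩
    sdeg G v +ℤ signVal G (edgeTo u σ v)    ≡⟨ cong (λ e → sdeg G v +ℤ signVal G e) (edgeTo-other σ v≢u) ⟩
    sdeg G v +ℤ + 0                         ≡⟨ ℤ.+-identityʳ (sdeg G v) ⟩
    sdeg G v                                ∎
    where open ≡-Reasoning

addLeaves : ∀ {n} m → SignedGraph n → Fin n → SignedGraph (m + n)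
addLeaves zero    G u = G
addLeaves (suc m) G u = addLeaf (addLeaves m G u) (m ↑ʳ u) pos

↑ˡ≢↑ʳ : ∀ {m n} (i : Fin m) (j : Fin n) → i ↑ˡ n ≢ m ↑ʳ j
↑ˡ≢↑ʳ zero    j ()
↑ˡ≢↑ʳ (suc i) j e = ↑ˡ≢↑ʳ i j (Finₚ.suc-injective e)

module _ {n : ℕ} (G : SignedGraph n) (u : Fin n) where

  IsTree-addLeaves : ∀ m → IsTree G → IsTree (addLeaves m G u)
  IsTree-addLeaves zero    tree = tree
  IsTree-addLeaves (suc m) tree = IsTree-addLeaf _ (m ↑ʳ u) pos (IsTree-addLeaves m tree)

  sdeg-addLeaves-anchor : ∀ m → sdeg (addLeaves m G u) (m ↑ʳ u) ≡ sdeg G u +ℤ + m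
  sdeg-addLeaves-anchor zero    = sym (ℤ.+-identityʳ (sdeg G u))
  sdeg-addLeaves-anchor (suc m) = begin
    sdeg (addLeaves (suc m) G u) (suc m ↑ʳ u)  ≡⟨ sdeg-addLeaf-anchor (addLeaves m G u) (m ↑ʳ u) pos ⟩
    sdeg (addLeaves m G u) (m ↑ʳ u) +ℤ + 1     ≡⟨ cong (_+ℤ + 1) (sdeg-addLeaves-anchor m) ⟩
    sdeg G u +ℤ + m +ℤ + 1                     ≡⟨ ℤ.+-assoc (sdeg G u) (+ m) (+ 1) ⟩
    sdeg G u +ℤ (+ m +ℤ + 1)                   ≡⟨ cong (sdeg G u +ℤ_) (trans (ℤ.+-comm (+ m) (+ 1)) (sym (ℤ.pos-+ 1 m))) ⟩
    sdeg G u +ℤ + suc m                        ∎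
    where open ≡-Reasoning

  sdeg-addLeaves-other : ∀ m {v} → v ≢ u → sdeg (addLeaves m G u) (m ↑ʳ v) ≡ sdeg G v
  sdeg-addLeaves-other zero    v≢u = refl
  sdeg-addLeaves-other (suc m) v≢u =
    trans (sdeg-addLeaf-other (addLeaves m G u) (m ↑ʳ u) pos (v≢u ∘ ↑ʳ-injective m _ _))
          (sdeg-addLeaves-other m v≢u)

  sdeg-addLeaves-leaf : ∀ m (i : Fin m) → sdeg (addLeaves m G u) (i ↑ˡ n) ≡ + 1
  sdeg-addLeaves-leaf (suc m) zero    = sdeg-addLeaf-leaf (addLeaves m G u) (m ↑ʳ u) pos
  sdeg-addLeaves-leaf (suc m) (suc i) =
    trans (sdeg-addLeaf-other (addLeaves m G u) (m ↑ʳ u) pos (↑ˡ≢↑ʳ i u))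
          (sdeg-addLeaves-leaf m i)

-- A realizing tree with Σᵢ (xᵢ − 1) + 4 vertices

isolated : SignedGraph 1
isolated = record { s = λ _ _ → nothing ; symm = λ _ _ → refl ; loopless = λ _ → refl }

IsTree-isolated : IsTree isolated
IsTree-isolated = (λ { zero zero → here }) , λ { _ [] (() , _) ; _ (_ ∷ _) (_ , _ , ((_ , ()) ∷ _)) }

-- the path  0 ─(+)─ 1 ─(−)─ 3 ─(+)─ 2  with signed degrees 1, 0, 0, 1
seedPath : SignedGraph 4
seedPath = addLeaf (addLeaf (addLeaf isolated zero pos) (suc zero) neg) zero pos

IsTree-seedPath : IsTree seedPath
IsTree-seedPath =
  IsTree-addLeaf _ zero pos (IsTree-addLeaf _ (suc zero) neg (IsTree-addLeaf _ zero pos IsTree-isolated))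

excess : ℕ → ℕ
excess zero    = 1
excess (suc k) = k

totalExcess : List ℤ → ℕ
totalExcess = sum ∘ map (excess ∘ ∣_∣)

module Construction (D : List ℤ) where

  record PartialRealization (R : List ℤ) (n : ℕ) : Set where
    field
      graph    : SignedGraph n
      isTree   : IsTree graph
      top      : Fin n
      sdeg-top : sdeg graph top ≡ + 1
      sdeg∈D   : ∀ v → sdeg graph v ∈ D
      covers   : ∀ d → d ∈ D → d ∈ R ⊎ ∃ λ v → sdeg graph v ≡ d

  realize-next : ∀ k {R n} → + (2 + k) ∈ D → PartialRealization (+ (2 + k) ∷ R) n → PartialRealization R (suc k + n)
  realize-next k {R} {n} x∈D p = record
    { graph = G′ ; isTree = IsTree-addLeaves graph top (suc k) isTree ; top = zero
    ; sdeg-top = sdeg-addLeaves-leaf graph top (suc k) zero ; sdeg∈D = sdeg∈D′ ; covers = covers′ }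
    where
    open PartialRealization p
    G′ : SignedGraph (suc k + n)
    G′ = addLeaves (suc k) graph top
    anchor : sdeg G′ (suc k ↑ʳ top) ≡ + (2 + k)
    anchor = trans (sdeg-addLeaves-anchor graph top (suc k)) (cong (_+ℤ + suc k) sdeg-top)
    sdeg∈D′ : ∀ v → sdeg G′ v ∈ D
    sdeg∈D′ v with splitAt (suc k) v in split
    ... | inj₁ i = subst (λ w → sdeg G′ w ∈ D) (splitAt⁻¹-↑ˡ {i = v} split)
                     (subst (_∈ D) (trans sdeg-top (sym (sdeg-addLeaves-leaf graph top (suc k) i))) (sdeg∈D top))
    ... | inj₂ w with w ≟ top
    ...   | yes refl = subst (λ w → sdeg G′ w ∈ D) (splitAt⁻¹-↑ʳ {i = v} split) (subst (_∈ D) (sym anchor) x∈D)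
    ...   | no w≢top = subst (λ w → sdeg G′ w ∈ D) (splitAt⁻¹-↑ʳ {i = v} split)
                         (subst (_∈ D) (sym (sdeg-addLeaves-other graph top (suc k) w≢top)) (sdeg∈D w))
    covers′ : ∀ d → d ∈ D → d ∈ R ⊎ ∃ λ v → sdeg G′ v ≡ d
    covers′ d d∈D with covers d d∈D
    ... | inj₁ (here d≡x)   = inj₂ (suc k ↑ʳ top , trans anchor (sym d≡x))
    ... | inj₁ (there d∈R)  = inj₁ d∈R
    ... | inj₂ (v , v↦d) with v ≟ top
    ...   | yes refl  = inj₂ (zero , trans (sdeg-addLeaves-leaf graph top (suc k) zero) (trans (sym sdeg-top) v↦d))
    ...   | no v≢top = inj₂ (suc k ↑ʳ v , trans (sdeg-addLeaves-other graph top (suc k) v≢top) v↦d)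

  realize-all : ∀ R {n} → All (+ 1 <_) R → (∀ {x} → x ∈ R → x ∈ D) →
                PartialRealization R n → PartialRealization [] (totalExcess R + n)
  realize-all []      []         _    p = p
  realize-all (.(+ (2 + k)) ∷ R) {n} (+<+ (s≤s (s≤s {n = k} z≤n)) ∷ 1<R) R⊆D p =
    subst (PartialRealization []) (reassoc (totalExcess R) (suc k) n)
      (realize-all R 1<R (R⊆D ∘ there) (realize-next k (R⊆D (here refl)) p))
    where
    reassoc : ∀ a b c → a + (b + c) ≡ b + a + c
    reassoc a b c = trans (sym (+-assoc a b c)) (cong (_+ c) (+-comm a b))

  realization : ∀ {n} → PartialRealization [] n → Σ (SignedTree n) (RealizedBy D)
  realization p = record { graph = graph ; isTree = isTree } , sdeg∈D , realized
    where
    open PartialRealization p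
    realized : ∀ d → d ∈ D → ∃ λ v → sdeg graph v ≡ d
    realized d d∈D with covers d d∈D
    ... | inj₂ found = found

upper-bound : ∀ xs → All (+ 1 <_) xs → Σ (SignedTree (totalExcess xs + 4)) (RealizedBy (+ 1 ∷ + 0 ∷ xs))
upper-bound xs 1<xs = realization (realize-all xs 1<xs (there ∘ there) seed)
  where
  open Construction (+ 1 ∷ + 0 ∷ xs)
  seed : PartialRealization xs 4
  seed = record
    { graph = seedPath ; isTree = IsTree-seedPath ; top = zero ; sdeg-top = refl
    ; sdeg∈D = λ { zero → here refl ; (suc zero) → there (here refl) ; (suc (suc zero)) → here refl
                 ; (suc (suc (suc zero))) → there (here refl) }
    ; covers = λ { d (here refl) → inj₂ (zero , refl)
                 ; d (there (here refl)) → inj₂ (suc zero , refl)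
                 ; d (there (there d∈xs)) → inj₁ d∈xs } }

-- Lower bound on the number of vertices

excess+1≤ : ∀ k m → 1 ≤ k + 2 * m → excess k + 1 ≤ k + 2 * m
excess+1≤ zero    (suc m) _ = *-monoʳ-≤ 2 (s≤s z≤n)
excess+1≤ (suc k) m       _ = subst (_≤ suc k + 2 * m) (+-comm 1 k) (m≤m+n (suc k) (2 * m))

excess+3≤ : ∀ k m → 1 ≤ k → 1 ≤ m → excess k + 3 ≤ k + 2 * m
excess+3≤ (suc k) (suc m) _ _ =
  subst (_≤ suc k + 2 * suc m) (sym (+-suc k 2)) (+-monoʳ-≤ (suc k) (*-monoʳ-≤ 2 (s≤s z≤n)))

module _ {n : ℕ} (G : SignedGraph n) {v : Fin n} (0≤sdeg : + 0 ≤ℤ sdeg G v) where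
  private
    deg≡ : deg G v ≡ ∣ sdeg G v ∣ + 2 * negDeg G v
    deg≡ = deg≡sdeg+2*negDeg G (sym (ℤ.0≤i⇒+∣i∣≡i 0≤sdeg))

  excess+1≤deg : 1 ≤ deg G v → excess ∣ sdeg G v ∣ + 1 ≤ deg G v
  excess+1≤deg 1≤deg = subst (excess ∣ sdeg G v ∣ + 1 ≤_) (sym deg≡)
    (excess+1≤ ∣ sdeg G v ∣ (negDeg G v) (subst (1 ≤_) deg≡ 1≤deg))

  excess+3≤deg : sdeg G v ≢ + 0 → 1 ≤ negDeg G v → excess ∣ sdeg G v ∣ + 3 ≤ deg G v
  excess+3≤deg sdeg≢0 1≤negDeg = subst (excess ∣ sdeg G v ∣ + 3 ≤_) (sym deg≡)
    (excess+3≤ ∣ sdeg G v ∣ (negDeg G v) 1≤∣sdeg∣ 1≤negDeg)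
    where
    1≤∣sdeg∣ : 1 ≤ ∣ sdeg G v ∣
    1≤∣sdeg∣ = n≢0⇒n>0 λ ∣sdeg∣≡0 → sdeg≢0 (ℤ.∣i∣≡0⇒i≡0 ∣sdeg∣≡0)

module _ {n : ℕ} (G : SignedGraph n) where
  open SignedGraph G

  negEdge⇒1≤negDeg : ∀ {a b} → s a b ≡ just neg → 1 ≤ negDeg G a
  negEdge⇒1≤negDeg {a} {b} ab⁻ = subst (λ e → isNeg e ≤ negDeg G a) ab⁻ (term≤∑ (isNeg ∘ s a) b)

  Connected⇒1≤deg : Connected G → ∀ {a b} → Adj G a b → ∀ v → 1 ≤ deg G v
  Connected⇒1≤deg connected {a} {b} a~b v with v ≟ a
  ... | yes refl = Adj⇒1≤deg G a~b
  ... | no v≢a with connected v a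
  ...   | here         = ⊥-elim (v≢a refl)
  ...   | step v~w _   = Adj⇒1≤deg G v~w

totalExcess≤∑ : ∀ {n} (f : Fin n → ℤ) {D} → Unique D → (∀ d → d ∈ D → ∃ λ v → f v ≡ d) →
                totalExcess D ≤ ∑ (excess ∘ ∣_∣ ∘ f)
totalExcess≤∑ f {D} uniq surjects with preimages f D surjects
... | vs , refl =
  subst (_≤ ∑ (excess ∘ ∣_∣ ∘ f)) (cong sum (map-∘ vs))
    (sum-map-≤-∑ (excess ∘ ∣_∣ ∘ f) (Uniqueₚ.map⁻ uniq))

totalExcess+4≤size : ∀ {D N} (T : SignedTree N) → RealizedBy D T → Unique D → All (+ 0 ≤ℤ_) D →
                ∀ {a b} → SignedGraph.s (SignedTree.graph T) a b ≡ just neg →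
                sdeg (SignedTree.graph T) a ≢ + 0 → totalExcess D + 4 ≤ N
totalExcess+4≤size {D} {N} T (sdeg∈D , realized) uniq 0≤D {a} {b} ab⁻ sdeg≢0 =
  +-cancelʳ-≤ N (totalExcess D + 4) N (begin
    totalExcess D + 4 + N                  ≤⟨ +-monoˡ-≤ N (+-monoˡ-≤ 4 (totalExcess≤∑ (sdeg G) uniq realized)) ⟩
    ∑ excess-at + 4 + N                    ≡⟨ shuffle (∑ excess-at) N ⟩
    ∑ excess-at + ∑ {N} (const 1) + 2 + 2  ≡⟨ cong (λ x → x + 2 + 2) (∑-distrib-+ excess-at (const 1)) ⟨
    ∑ (λ v → excess-at v + 1) + 2 + 2      ≤⟨ +-monoˡ-≤ 2 (∑-mono-≤-slack {i = a} excess+1≤deg′ excess+3≤deg′) ⟩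
    ∑ (deg G) + 2                          ≤⟨ ∑deg+2≤2n G a acyclic ⟩
    2 * N                                  ≡⟨ cong (_+_ N) (+-identityʳ N) ⟩
    N + N                                  ∎)
  where
  open ≤-Reasoning
  G : SignedGraph N
  G = SignedTree.graph T
  connected : Connected G
  connected = proj₁ (SignedTree.isTree T)
  acyclic : Acyclic G
  acyclic = proj₂ (SignedTree.isTree T)
  excess-at : Fin N → ℕ
  excess-at = excess ∘ ∣_∣ ∘ sdeg G
  0≤sdeg : ∀ v → + 0 ≤ℤ sdeg G v
  0≤sdeg v = All.lookup 0≤D (sdeg∈D v)
  shuffle : ∀ e n → e + 4 + n ≡ e + ∑ {n} (const 1) + 2 + 2
  shuffle e n = trans (regroup e n) (cong (λ x → e + x + 2 + 2) (sym (∑-ones n)))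
    where
    regroup : ∀ e n → e + 4 + n ≡ e + n + 2 + 2
    regroup = ℕ-Solver.solve-∀
  excess+1≤deg′ : ∀ v → excess-at v + 1 ≤ deg G v
  excess+1≤deg′ v = excess+1≤deg G (0≤sdeg v) (Connected⇒1≤deg G connected (neg , ab⁻) v)
  excess+3≤deg′ : excess-at a + 1 + 2 ≤ deg G a
  excess+3≤deg′ = subst (_≤ deg G a) (sym (+-assoc (excess-at a) 1 2))
    (excess+3≤deg G (0≤sdeg a) sdeg≢0 (negEdge⇒1≤negDeg G ab⁻))

mainTheorem8 : (xs : List ℤ) → 1 ≤ length xs → Unique xs → All (λ x → + 1 < x) xs →
    {N : ℕ} (T : SignedTree N) → Optimal (+ 1 ∷ + 0 ∷ xs) T →
    ∀ a b → SignedGraph.s (SignedTree.graph T) a b ≡ just neg →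
    sdeg (SignedTree.graph T) a ≡ + 0 × sdeg (SignedTree.graph T) b ≡ + 0
mainTheorem8 xs _ uniq 1<xs {N} T (realizes , minimal) a b ab⁻ =
  endpoint-sdeg≡0 ab⁻ , endpoint-sdeg≡0 (trans (symm b a) ab⁻)
  where
  open SignedGraph (SignedTree.graph T)
  0<xs : All (+ 0 <_) xs
  0<xs = All.map (ℤ.<-trans (+<+ (s≤s z≤n))) 1<xs
  uniq-D : Unique (+ 1 ∷ + 0 ∷ xs)
  uniq-D = ((λ ()) ∷ All.map ℤ.<⇒≢ 1<xs) ∷ All.map ℤ.<⇒≢ 0<xs ∷ uniq
  0≤D : All (+ 0 ≤ℤ_) (+ 1 ∷ + 0 ∷ xs)
  0≤D = +≤+ z≤n ∷ +≤+ z≤n ∷ All.map ℤ.<⇒≤ 0<xs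
  N≤excess+4 : N ≤ totalExcess xs + 4
  N≤excess+4 = minimal _ (proj₁ (upper-bound xs 1<xs)) (proj₂ (upper-bound xs 1<xs))
  endpoint-sdeg≡0 : ∀ {a b} → s a b ≡ just neg → sdeg (SignedTree.graph T) a ≡ + 0
  endpoint-sdeg≡0 {a} ab⁻ = decidable-stable (sdeg (SignedTree.graph T) a ℤ.≟ + 0) λ sdeg≢0 →
    <⇒≱ (totalExcess+4≤size T realizes uniq-D 0≤D ab⁻ sdeg≢0) N≤excess+4
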